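{- Let $w,d,t$ be positive integers and let $G$ be a star graph with $t+1$ vertices. Then $N(G,w;d)=N((1,w;d),t)$.
   Context: An $(r,w;d)$-CFF$(n,t)$ is a pair $(X,B)$ with $|X|=n$ and $B=\{B_1,\ldots,B_t\}$ subsets of $X$ such that for any $L,M\subseteq[t]$ with $L\cap M=\emptyset$, $|L|=r$, $|M|=w$, we have $|(\bigcap_{l\in L}B_l)\setminus(\bigcup_{m\in M}B_m)|\geq d$; $N((r,w;d),t)$ is the minimum $n$ for which one exists. For a graph $G$, a collection $\{A_1,\ldots,A_n\}$ of subsets of $V(G)$ is a $(w,d)$-covering of $G$ if for every edge $\{u,v\}$ and every $w$-subset $W\subseteq V(G)$ disjoint from $\{u,v\}$ there are at least $d$ sets $A_j$ with $\{u,v\}\subseteq A_j$ and $W\cap A_j=\emptyset$; $N(G,w;d)$ is the minimum size of a $(w,d)$-covering of $G$. -}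

module Defs where

open import Data.Nat using (ℕ; zero; suc; _≤_)
open import Data.Fin using (Fin; zero; suc)
open import Data.Fin.Subset using (Subset; _∈_; _∉_; _∩_; ∣_∣; Empty)
open import Data.Product using (Σ; _×_)
open import Data.Sum using (_⊎_)
open import Relation.Binary.PropositionalEquality using (_≡_; _≢_)
open import Relation.Nullary using (¬_)

AtLeast : (d n : ℕ) → (Fin n → Set) → Set
AtLeast d n P = Σ (Subset n) λ S → (d ≤ ∣ S ∣) × (∀ x → x ∈ S → P x)

IsCFF : (r w d n t : ℕ) → (Fin t → Subset n) → Set
IsCFF r w d n t B =
  (L M : Subset t) → ∣ L ∣ ≡ r → ∣ M ∣ ≡ w → Empty (L ∩ M) →
  AtLeast d n (λ x → (∀ l → l ∈ L → x ∈ B l) × (∀ m → m ∈ M → x ∉ B m))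

CFFExists : (r w d t n : ℕ) → Set
CFFExists r w d t n = Σ (Fin t → Subset n) (IsCFF r w d n t)

IsMinimum : (ℕ → Set) → ℕ → Set
IsMinimum P m = P m × (∀ k → P k → m ≤ k)

record SimpleGraph (V : ℕ) : Set₁ where
  field
    Adj    : Fin V → Fin V → Set
    sym    : ∀ {u v} → Adj u v → Adj v u
    irrefl : ∀ {u} → ¬ Adj u u

open SimpleGraph public

IsCovering : {V : ℕ} → SimpleGraph V → (w d n : ℕ) → (Fin n → Subset V) → Set
IsCovering {V} G w d n A =
  (u v : Fin V) → Adj G u v → (W : Subset V) → ∣ W ∣ ≡ w → u ∉ W → v ∉ W →
  AtLeast d n (λ j → u ∈ A j × v ∈ A j × Empty (W ∩ A j))

CoveringExists : {V : ℕ} → SimpleGraph V → (w d n : ℕ) → Set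
CoveringExists G w d n = Σ (Fin _ → Subset _) (IsCovering G w d n)

starAdj : (t : ℕ) → Fin (suc t) → Fin (suc t) → Set
starAdj t u v = (u ≡ zero × v ≢ zero) ⊎ (v ≡ zero × u ≢ zero)

Star : (t : ℕ) → SimpleGraph (suc t)
Star t = record { Adj = starAdj t ; sym = s ; irrefl = i }
  where
  open import Data.Sum using (inj₁; inj₂)
  open import Data.Product using (_,_)
  s : ∀ {u v} → starAdj t u v → starAdj t v u
  s (inj₁ p) = inj₂ p
  s (inj₂ p) = inj₁ p
  i : ∀ {u} → ¬ starAdj t u u
  i (inj₁ (p , q)) = q p
  i (inj₂ (p , q)) = q p

-- On a star every edge joins the centre to a leaf, and a forbidden set W must avoid the centre, so a
-- (w,d)-covering only ever asks, for a leaf l and a w-set M of other leaves, for d sets containing the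
-- centre and l but no leaf of M. Reading the set A_j as the column {i | A_j contains the centre and
-- leaf i} of a t × n incidence matrix, and conversely adding the centre to every column of a
-- (1,w;d)-CFF, translates this condition word for word into the cover-free condition with |L| = 1.
-- Both translations preserve the number n of sets, so the two minima coincide.
module Submission where

open import Defs hiding (sym)
open import Data.Nat using (ℕ; suc; _≥_)
open import Data.Nat.Properties using (suc-injective)
open import Data.Bool using (Bool; true; _∧_)
open import Data.Bool.Properties using (∧-conicalˡ; ∧-conicalʳ)
open import Data.Fin using (Fin; zero; suc)
open import Data.Fin.Subset using (Subset; _∈_; _∉_; _∩_; ∣_∣; Empty; inside; outside; ⊥; ⁅_⁆)
open import Data.Fin.Subset.Properties using (x∈p∩q⁺; x∈p∩q⁻; x∈⁅x⁆; x∈⁅y⁆⇒x≡y; ∣⁅x⁆∣≡1)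
open import Data.Vec using ([]; _∷_; here; there; lookup; tabulate)
open import Data.Vec.Properties using ([]=⇒lookup; lookup⇒[]=; lookup∘tabulate; tabulate∘lookup; tabulate-cong)
open import Data.Product using (∃; _×_; _,_; proj₁; proj₂)
open import Data.Sum using (inj₁; inj₂)
open import Data.Empty using (⊥-elim)
open import Function using (_∘_)
open import Function.Bundles using (_⇔_; mk⇔; Equivalence)
open import Relation.Binary.PropositionalEquality using (_≡_; refl; sym; trans; cong; cong₂; subst; module ≡-Reasoning)

open Equivalence using (to; from)

private
  variable
    n t w d : ℕ

AtLeast-map : {P Q : Fin n → Set} → (∀ x → P x → Q x) → AtLeast d n P → AtLeast d n Q
AtLeast-map P⇒Q (S , d≤∣S∣ , S⊆P) = S , d≤∣S∣ , λ x x∈S → P⇒Q x (S⊆P x x∈S)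

IsMinimum-cong : {P Q : ℕ → Set} → (∀ k → P k → Q k) → (∀ k → Q k → P k) →
                 ∀ m → IsMinimum P m ⇔ IsMinimum Q m
IsMinimum-cong P⇒Q Q⇒P m = mk⇔
  (λ (Pm , m≤P) → P⇒Q m Pm , λ k Qk → m≤P k (Q⇒P k Qk))
  (λ (Qm , m≤Q) → Q⇒P m Qm , λ k Pk → m≤Q k (P⇒Q k Pk))

∣p∣≡0⇒p≡⊥ : {p : Subset n} → ∣ p ∣ ≡ 0 → p ≡ ⊥
∣p∣≡0⇒p≡⊥ {p = []}          _     = refl
∣p∣≡0⇒p≡⊥ {p = outside ∷ p} ∣p∣≡0 = cong (outside ∷_) (∣p∣≡0⇒p≡⊥ ∣p∣≡0)

∣p∣≡1⇒p≡⁅x⁆ : {p : Subset n} → ∣ p ∣ ≡ 1 → ∃ λ x → p ≡ ⁅ x ⁆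
∣p∣≡1⇒p≡⁅x⁆ {p = inside  ∷ p} ∣p∣≡1 = zero , cong (inside ∷_) (∣p∣≡0⇒p≡⊥ (suc-injective ∣p∣≡1))
∣p∣≡1⇒p≡⁅x⁆ {p = outside ∷ p} ∣p∣≡1 =
  let x , p≡⁅x⁆ = ∣p∣≡1⇒p≡⁅x⁆ ∣p∣≡1 in suc x , cong (outside ∷_) p≡⁅x⁆

∈-tabulate⇔ : ∀ {f : Fin n → Bool} {x} → x ∈ tabulate f ⇔ f x ≡ true
∈-tabulate⇔ {f = f} {x} = mk⇔
  (λ x∈ → trans (sym (lookup∘tabulate f x)) ([]=⇒lookup x∈))
  (λ fx≡true → lookup⇒[]= x _ (trans (lookup∘tabulate f x) fx≡true))

IsSingletonCFF : (w d n t : ℕ) → (Fin t → Subset n) → Set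
IsSingletonCFF w d n t B =
  ∀ l (M : Subset t) → ∣ M ∣ ≡ w → l ∉ M →
  AtLeast d n (λ x → x ∈ B l × (∀ m → m ∈ M → x ∉ B m))

isCFF⇔isSingletonCFF : {B : Fin t → Subset n} → IsCFF 1 w d n t B ⇔ IsSingletonCFF w d n t B
isCFF⇔isSingletonCFF {B = B} = mk⇔ singleton single⇒cff
  where
  singleton : IsCFF 1 _ _ _ _ B → IsSingletonCFF _ _ _ _ B
  singleton cff l M ∣M∣≡w l∉M =
    AtLeast-map (λ x (x∈B , x∉M) → x∈B l (x∈⁅x⁆ l) , x∉M)
      (cff ⁅ l ⁆ M (∣⁅x⁆∣≡1 l) ∣M∣≡w disjoint)
    where
    disjoint : Empty (⁅ l ⁆ ∩ M)
    disjoint (k , k∈) with x∈p∩q⁻ ⁅ l ⁆ M k∈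
    ... | k∈⁅l⁆ , k∈M = l∉M (subst (_∈ M) (x∈⁅y⁆⇒x≡y l k∈⁅l⁆) k∈M)

  single⇒cff : IsSingletonCFF _ _ _ _ B → IsCFF 1 _ _ _ _ B
  single⇒cff single L M ∣L∣≡1 ∣M∣≡w disjoint with ∣p∣≡1⇒p≡⁅x⁆ {p = L} ∣L∣≡1
  ... | l , refl =
    AtLeast-map (λ x (x∈Bl , x∉M) → (λ l′ l′∈ → subst (λ k → x ∈ B k) (sym (x∈⁅y⁆⇒x≡y l l′∈)) x∈Bl) , x∉M)
      (single l M ∣M∣≡w (λ l∈M → disjoint (l , x∈p∩q⁺ (x∈⁅x⁆ l , l∈M))))

IsSingletonCFF-resp : {B C : Fin t → Subset n} → (∀ i → B i ≡ C i) →
                      IsSingletonCFF w d n t B → IsSingletonCFF w d n t C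
IsSingletonCFF-resp B≗C single l M ∣M∣≡w l∉M =
  AtLeast-map (λ x (x∈Bl , x∉M) → subst (x ∈_) (B≗C l) x∈Bl ,
                                  λ m m∈M → x∉M m m∈M ∘ subst (x ∈_) (sym (B≗C m)))
    (single l M ∣M∣≡w l∉M)

leafBlocks : (Fin n → Subset (suc t)) → Fin t → Subset n
leafBlocks A i = tabulate λ j → lookup (A j) zero ∧ lookup (A j) (suc i)

∈-leafBlocks⇔ : ∀ {A : Fin n → Subset (suc t)} {i j} → j ∈ leafBlocks A i ⇔ (zero ∈ A j × suc i ∈ A j)
∈-leafBlocks⇔ {A = A} {i} {j} = mk⇔
  (λ j∈ → let both = to ∈-tabulate⇔ j∈ in
            lookup⇒[]= zero (A j) (∧-conicalˡ _ _ both) , lookup⇒[]= (suc i) (A j) (∧-conicalʳ _ _ both))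
  (λ (z , s) → from ∈-tabulate⇔ (cong₂ _∧_ ([]=⇒lookup z) ([]=⇒lookup s)))

starFamily : (Fin t → Subset n) → Fin n → Subset (suc t)
starFamily B j = inside ∷ tabulate λ i → lookup (B i) j

leafBlocks-starFamily : (B : Fin t → Subset n) → ∀ i → leafBlocks (starFamily B) i ≡ B i
leafBlocks-starFamily B i = begin
  tabulate (λ j → lookup (tabulate λ i′ → lookup (B i′) j) i) ≡⟨ tabulate-cong (λ j → lookup∘tabulate _ i) ⟩
  tabulate (lookup (B i))                                     ≡⟨ tabulate∘lookup (B i) ⟩
  B i                                                         ∎
  where open ≡-Reasoning

isCovering⇔isSingletonCFF : {A : Fin n → Subset (suc t)} →
                            IsCovering (Star t) w d n A ⇔ IsSingletonCFF w d n t (leafBlocks A)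
isCovering⇔isSingletonCFF {n = n} {t = t} {w = w} {d = d} {A = A} = mk⇔ covering⇒single single⇒covering
  where
  ∈B⇔ : ∀ {i j} → j ∈ leafBlocks A i ⇔ (zero ∈ A j × suc i ∈ A j)
  ∈B⇔ = ∈-leafBlocks⇔ {A = A}

  CoversAt : Fin t → Subset (suc t) → Fin n → Set
  CoversAt l W j = zero ∈ A j × suc l ∈ A j × Empty (W ∩ A j)

  SeparatesAt : Fin t → Subset t → Fin n → Set
  SeparatesAt l M j = j ∈ leafBlocks A l × (∀ m → m ∈ M → j ∉ leafBlocks A m)

  covers⇒separates : ∀ l M j → CoversAt l (outside ∷ M) j → SeparatesAt l M j
  covers⇒separates l M j (z , s , avoids) =
    from ∈B⇔ (z , s) ,
    λ m m∈M j∈Bm → avoids (suc m , x∈p∩q⁺ (there m∈M , proj₂ (to ∈B⇔ j∈Bm)))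

  -- A leaf of M inside A j would put j into its leaf block, because A j already contains the centre.
  separates⇒covers : ∀ l M j → SeparatesAt l M j → CoversAt l (outside ∷ M) j
  separates⇒covers l M j (j∈Bl , j∉BM) = z , s , avoids
    where
    z : zero ∈ A j
    z = proj₁ (to ∈B⇔ j∈Bl)
    s : suc l ∈ A j
    s = proj₂ (to ∈B⇔ j∈Bl)
    avoids : Empty ((outside ∷ M) ∩ A j)
    avoids (k , k∈) with x∈p∩q⁻ (outside ∷ M) (A j) k∈
    avoids (suc m , _) | there m∈M , sm∈ = j∉BM m m∈M (from ∈B⇔ (z , sm∈))

  covering⇒single : IsCovering (Star t) w d n A → IsSingletonCFF w d n t (leafBlocks A)
  covering⇒single cov l M ∣M∣≡w l∉M =
    AtLeast-map (covers⇒separates l M)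
      (cov zero (suc l) (inj₁ (refl , λ ())) (outside ∷ M) ∣M∣≡w (λ ()) λ { (there l∈M) → l∉M l∈M })

  leafEdge : IsSingletonCFF w d n t (leafBlocks A) → ∀ l W → ∣ W ∣ ≡ w → zero ∉ W → suc l ∉ W →
             AtLeast d n (CoversAt l W)
  leafEdge single l (inside  ∷ M) _     0∉W _ = ⊥-elim (0∉W here)
  leafEdge single l (outside ∷ M) ∣W∣≡w _   l∉W =
    AtLeast-map (separates⇒covers l M) (single l M ∣W∣≡w (l∉W ∘ there))

  single⇒covering : IsSingletonCFF w d n t (leafBlocks A) → IsCovering (Star t) w d n A
  single⇒covering single zero    (suc l) _   = leafEdge single l
  single⇒covering single (suc l) zero    _   W ∣W∣≡w l∉W 0∉W =
    AtLeast-map (λ _ (z , s , avoids) → s , z , avoids) (leafEdge single l W ∣W∣≡w 0∉W l∉W)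
  single⇒covering single zero    zero    adj = ⊥-elim (irrefl (Star t) adj)
  single⇒covering single (suc _) (suc _) (inj₁ (() , _))
  single⇒covering single (suc _) (suc _) (inj₂ (() , _))

covering⇒cff : ∀ n → CoveringExists (Star t) w d n → CFFExists 1 w d t n
covering⇒cff n (A , cov) = leafBlocks A , from isCFF⇔isSingletonCFF (to isCovering⇔isSingletonCFF cov)

cff⇒covering : ∀ n → CFFExists 1 w d t n → CoveringExists (Star t) w d n
cff⇒covering n (B , cff) =
  starFamily B ,
  from isCovering⇔isSingletonCFF
    (IsSingletonCFF-resp (sym ∘ leafBlocks-starFamily B) (to isCFF⇔isSingletonCFF cff))

lemma3p8 : (w d t : ℕ) → w ≥ 1 → d ≥ 1 → t ≥ 1 →
    (m : ℕ) → IsMinimum (CoveringExists (Star t) w d) m ⇔ IsMinimum (CFFExists 1 w d t) m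
lemma3p8 w d t _ _ _ = IsMinimum-cong covering⇒cff cff⇒covering
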